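{- (i) The map $\vec\alpha\mapsto[\vec\alpha]$ is an isomorphism between the ordered set $(I,\le_{\mathfrak{I}})$ and the ordered set $\mathfrak{T}^0_{\mathrm{RC}}$ of bounded $\mathrm{RC}$-theories ordered by $T\le_{\mathrm{RC}}S$ iff $T\supseteq S$. (ii) The map $T\mapsto v(T)$ is an isomorphism between $(\mathfrak{T}^0_{\mathrm{RC}},\le_{\mathrm{RC}})$ and the set of cones in $\mathcal{I}$ ordered by inclusion.
   Context: $\mathrm{RC}$-formulas are variable-free strictly positive formulas built from $\top$ by $\land$ and $\Diamond_n$ ($n<\omega$). $\mathrm{RC}$ is the smallest set of sequents $A\vdash B$ closed under: $A\vdash A$; $A\vdash\top$; $A\land B\vdash A$; $A\land B\vdash B$; from $A\vdash B$, $B\vdash C$ infer $A\vdash C$; from $A\vdash B$, $A\vdash C$ infer $A\vdash B\land C$; from $A\vdash B$ infer $\Diamond_nA\vdash\Diamond_nB$; $\Diamond_n\Diamond_nA\vdash\Diamond_nA$; and for $m<n$: $\Diamond_nA\vdash\Diamond_mA$, $\Diamond_nA\land\Diamond_mB\vdash\Diamond_n(A\land\Diamond_mB)$. An $\mathrm{RC}$-theory is a set $T$ of $\mathrm{RC}$-formulas such that $B\in T$ whenever $A_1\land\dots\land A_k\vdash_{\mathrm{RC}}B$ for some $A_1,\dots,A_k\in T$; it is bounded if $T\subseteq\{B:A\vdash_{\mathrm{RC}}B\}$ for some formula $A$. With $\ell(0)=0$, $\ell(\delta+\omega^\gamma)=\gamma$, $I$ is the set of $\omega$-sequences $\vec\alpha$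 of ordinals $<\varepsilon_0$ with $\alpha_{i+1}\le\ell(\alpha_i)$; $\vec\alpha R_n\vec\beta$ iff $\alpha_i=\beta_i$ for $i<n$ and $\alpha_n>\beta_n$; $\mathcal{I}=(I,(R_n))$ is a Kripke frame with forcing $\vec\alpha\Vdash\top$, $\vec\alpha\Vdash A\land B$ iff both, $\vec\alpha\Vdash\Diamond_nA$ iff $\exists\vec\beta(\vec\alpha R_n\vec\beta\land\vec\beta\Vdash A)$. $[\vec\alpha]=\{A:\mathcal{I},\vec\alpha\Vdash A\}$; $v(T)=\{\vec\alpha\in I:\mathcal{I},\vec\alpha\Vdash B\text{ for all }B\in T\}$. $\vec\alpha\le_{\mathfrak{I}}\vec\beta$ iff $\alpha_i\ge\beta_i$ for all $i$ (for arbitrary $\omega$-sequences of ordinals $\le\varepsilon_0$). Let $\mathcal{E}$ be the set of all $\omega$-sequences of ordinals $\le\varepsilon_0$ and $C_{\vec\alpha}=\{\vec\beta\in\mathcal{E}:\vec\beta\le_{\mathfrak{I}}\vec\alpha\}$; a cone in $\mathcal{I}$ is a nonempty set of the form $C_{\vec\alpha}\cap I$ with $\vec\alpha\in\mathcal{E}$. -}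

module Defs where

open import Data.Nat using (ℕ; zero; suc) renaming (_<_ to _<ℕ_)
open import Data.Product using (Σ; ∃; _×_; _,_)
open import Data.Sum using (_⊎_)
open import Data.List using (List; []; _∷_)
open import Data.List.Relation.Unary.All using (All)
open import Relation.Binary.PropositionalEquality using (_≡_)

data Tm : Set where
  𝟎     : Tm
  ω^_+_ : Tm → Tm → Tm

-- Lexicographic order on terms (the ordinal order on normal forms)
data _<ᵗ_ : Tm → Tm → Set where
  <-zero : ∀ {a b} → 𝟎 <ᵗ (ω^ a + b)
  <-exp  : ∀ {a b c d} → a <ᵗ c → (ω^ a + b) <ᵗ (ω^ c + d)
  <-tail : ∀ {a b d} → b <ᵗ d → (ω^ a + b) <ᵗ (ω^ a + d)

_≤ᵗ_ : Tm → Tm → Set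
a ≤ᵗ b = a <ᵗ b ⊎ a ≡ b

data IsCNF : Tm → Set where
  cnf-0 : IsCNF 𝟎
  cnf-1 : ∀ {a} → IsCNF a → IsCNF (ω^ a + 𝟎)
  cnf-+ : ∀ {a c d} → IsCNF a → IsCNF (ω^ c + d) → c ≤ᵗ a →
          IsCNF (ω^ a + (ω^ c + d))

record Ord : Set where
  constructor ord
  field
    tm  : Tm
    cnf : IsCNF tm
open Ord public

ℓ : Tm → Tm
ℓ 𝟎                   = 𝟎
ℓ (ω^ a + 𝟎)          = a
ℓ (ω^ a + (ω^ c + d)) = ℓ (ω^ c + d)

data Ordε : Set where
  fin : Ord → Ordε
  ε₀  : Ordε

data _≤ε_ : Ordε → Ordε → Set where
  fin≤fin : ∀ {a b} → tm a ≤ᵗ tm b → fin a ≤ε fin b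
  fin≤ε₀  : ∀ {a} → fin a ≤ε ε₀
  ε₀≤ε₀   : ε₀ ≤ε ε₀

record ISeq : Set where
  constructor iseq
  field
    seq : ℕ → Ord
    wf  : ∀ i → tm (seq (suc i)) ≤ᵗ ℓ (tm (seq i))
open ISeq public

R : ℕ → ISeq → ISeq → Set
R n α β = (∀ i → i <ℕ n → tm (seq α i) ≡ tm (seq β i))
        × tm (seq β n) <ᵗ tm (seq α n)

_≤I_ : ISeq → ISeq → Set
α ≤I β = ∀ i → tm (seq β i) ≤ᵗ tm (seq α i)

_≡I_ : ISeq → ISeq → Set
α ≡I β = ∀ i → tm (seq α i) ≡ tm (seq β i)

data Fm : Set where
  ⊤'  : Fm
  _∧_ : Fm → Fm → Fm
  ◇   : ℕ → Fm → Fm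

infix 3 _⊢_
data _⊢_ : Fm → Fm → Set where
  ax     : ∀ {A} → A ⊢ A
  top    : ∀ {A} → A ⊢ ⊤'
  ∧-el   : ∀ {A B} → (A ∧ B) ⊢ A
  ∧-er   : ∀ {A B} → (A ∧ B) ⊢ B
  cut    : ∀ {A B C} → A ⊢ B → B ⊢ C → A ⊢ C
  ∧-i    : ∀ {A B C} → A ⊢ B → A ⊢ C → A ⊢ (B ∧ C)
  ◇-mono : ∀ {n A B} → A ⊢ B → ◇ n A ⊢ ◇ n B
  trans4 : ∀ {n A} → ◇ n (◇ n A) ⊢ ◇ n A
  mono   : ∀ {m n A} → m <ℕ n → ◇ n A ⊢ ◇ m A
  J      : ∀ {m n A B} → m <ℕ n → (◇ n A ∧ ◇ m B) ⊢ ◇ n (A ∧ ◇ m B)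

conj : List Fm → Fm
conj []       = ⊤'
conj (A ∷ As) = A ∧ conj As

FmSet : Set₁
FmSet = Fm → Set

_⊆_ : FmSet → FmSet → Set
T ⊆ S = ∀ A → T A → S A

_≐_ : FmSet → FmSet → Set
T ≐ S = T ⊆ S × S ⊆ T

IsRCTheory : FmSet → Set
IsRCTheory T = ∀ As B → All T As → conj As ⊢ B → T B

Bounded : FmSet → Set
Bounded T = ∃ λ A → ∀ B → T B → A ⊢ B

IsBddTheory : FmSet → Set
IsBddTheory T = IsRCTheory T × Bounded T

_≤RC_ : FmSet → FmSet → Set
T ≤RC S = S ⊆ T

infix 3 _⊩_
_⊩_ : ISeq → Fm → Set
α ⊩ ⊤'      = Data.Unit.⊤
  where import Data.Unit
α ⊩ (A ∧ B) = (α ⊩ A) × (α ⊩ B)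
α ⊩ ◇ n A   = Σ ISeq λ β → R n α β × (β ⊩ A)

⟦_⟧ : ISeq → FmSet
⟦ α ⟧ A = α ⊩ A

ISet : Set₁
ISet = ISeq → Set

_⊆I_ : ISet → ISet → Set
K ⊆I L = ∀ α → K α → L α

_≐I_ : ISet → ISet → Set
K ≐I L = K ⊆I L × L ⊆I K

v : FmSet → ISet
v T α = ∀ B → T B → α ⊩ B

ESeq : Set
ESeq = ℕ → Ordε

_≤E_ : ESeq → ESeq → Set
β ≤E α = ∀ i → α i ≤ε β i

toE : ISeq → ESeq
toE α i = fin (seq α i)

Cone∩I : ESeq → ISet
Cone∩I α β = toE β ≤E α

IsCone : ISet → Set
IsCone K = (∃ λ α → K ≐I Cone∩I α) × (∃ λ β → K β)

-- Every formula is provably and semantically equivalent to a worm W x, x < ε₀ in Cantor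
-- normal form, and the models of W x in 𝓘 are exactly the sequences lying pointwise above
-- x, ℓ x, ℓ (ℓ x), …. Hence RC is sound and complete for 𝓘, forcing is upward closed, and
-- ⟦ α ⟧ determines α through the formulas sep i (α i) separating the i-th entries.
-- A bounded theory T equals ⟦ γ ⟧ for γ the pointwise supremum of the sequences of the worms
-- in T, which exists classically because the ordinals below ε₀ are well ordered; the sets
-- v T are then the cones above these γ.
module Submission where

open import Defs
open import Level using (0ℓ)
open import Axiom.ExcludedMiddle using (ExcludedMiddle)
open import Data.Nat using (ℕ; zero; suc; _+_; z≤n; s≤s)
  renaming (_<_ to _<ℕ_; _≤_ to _≤ℕ_)
import Data.Nat.Properties as ℕ
open import Data.Product using (Σ; ∃; _×_; _,_; proj₁; proj₂)
open import Data.Sum using (_⊎_; inj₁; inj₂)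
open import Data.Empty using (⊥; ⊥-elim)
open import Data.Unit using (tt)
open import Data.List using ([]; _∷_)
open import Data.List.Relation.Unary.All as All using (All; []; _∷_)
open import Function using (_∘_; case_of_)
open import Induction.WellFounded using (Acc; acc)
open import Relation.Nullary using (¬_; Dec; yes; no)
open import Relation.Binary.Definitions
  using (Transitive; Trichotomous; tri<; tri≈; tri>)
open import Relation.Binary.PropositionalEquality
  using (_≡_; _≢_; refl; sym; trans; cong; subst; subst₂; isEquivalence; resp₂)
import Relation.Binary.Construct.StrictToNonStrict _≡_ _<ᵗ_ as NonStrict

<ᵗ-irrefl : ∀ {x} → ¬ x <ᵗ x
<ᵗ-irrefl (<-exp p)  = <ᵗ-irrefl p
<ᵗ-irrefl (<-tail p) = <ᵗ-irrefl p

<ᵗ-trans : Transitive _<ᵗ_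
<ᵗ-trans <-zero     (<-exp q)  = <-zero
<ᵗ-trans <-zero     (<-tail q) = <-zero
<ᵗ-trans (<-exp p)  (<-exp q)  = <-exp (<ᵗ-trans p q)
<ᵗ-trans (<-exp p)  (<-tail q) = <-exp p
<ᵗ-trans (<-tail p) (<-exp q)  = <-exp q
<ᵗ-trans (<-tail p) (<-tail q) = <-tail (<ᵗ-trans p q)

<ᵗ-cmp : Trichotomous _≡_ _<ᵗ_
<ᵗ-cmp 𝟎 𝟎 = tri≈ (λ ()) refl (λ ())
<ᵗ-cmp 𝟎 (ω^ c + d) = tri< <-zero (λ ()) (λ ())
<ᵗ-cmp (ω^ a + b) 𝟎 = tri> (λ ()) (λ ()) <-zero
<ᵗ-cmp (ω^ a + b) (ω^ c + d) with <ᵗ-cmp a c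
... | tri< a<c a≢c _ = tri< (<-exp a<c) (λ { refl → a≢c refl })
                            (λ { (<-exp c<a) → <ᵗ-irrefl (<ᵗ-trans a<c c<a) ; (<-tail _) → a≢c refl })
... | tri> _ a≢c c<a = tri> (λ { (<-exp a<c) → <ᵗ-irrefl (<ᵗ-trans a<c c<a) ; (<-tail _) → a≢c refl })
                            (λ { refl → a≢c refl }) (<-exp c<a)
... | tri≈ _ refl _ with <ᵗ-cmp b d
...   | tri< b<d b≢d d≮b = tri< (<-tail b<d) (λ { refl → b≢d refl })
                                (λ { (<-exp a<a) → <ᵗ-irrefl a<a ; (<-tail d<b) → d≮b d<b })
...   | tri≈ b≮d refl _ = tri≈ (λ { (<-exp a<a) → <ᵗ-irrefl a<a ; (<-tail b<b) → b≮d b<b }) refl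
                                (λ { (<-exp a<a) → <ᵗ-irrefl a<a ; (<-tail b<b) → b≮d b<b })
...   | tri> b≮d b≢d d<b = tri> (λ { (<-exp a<a) → <ᵗ-irrefl a<a ; (<-tail b<d) → b≮d b<d })
                                (λ { refl → b≢d refl }) (<-tail d<b)

≤ᵗ-refl : ∀ {x} → x ≤ᵗ x
≤ᵗ-refl = inj₂ refl

≤ᵗ-trans : Transitive _≤ᵗ_
≤ᵗ-trans = NonStrict.trans isEquivalence (resp₂ _<ᵗ_) <ᵗ-trans

≤ᵗ-antisym : ∀ {x y} → x ≤ᵗ y → y ≤ᵗ x → x ≡ y
≤ᵗ-antisym = NonStrict.antisym isEquivalence <ᵗ-trans λ { refl → <ᵗ-irrefl }

<-≤ᵗ-trans : ∀ {x y z} → x <ᵗ y → y ≤ᵗ z → x <ᵗ z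
<-≤ᵗ-trans = NonStrict.<-≤-trans <ᵗ-trans (λ { refl p → p })

≤-<ᵗ-trans : ∀ {x y z} → x ≤ᵗ y → y <ᵗ z → x <ᵗ z
≤-<ᵗ-trans = NonStrict.≤-<-trans sym <ᵗ-trans (λ { refl p → p })

≮ᵗ⇒≥ : ∀ {x y} → ¬ x <ᵗ y → y ≤ᵗ x
≮ᵗ⇒≥ {x} {y} x≮y with <ᵗ-cmp x y
... | tri< x<y _ _ = ⊥-elim (x≮y x<y)
... | tri≈ _ x≡y _ = inj₂ (sym x≡y)
... | tri> _ _ y<x = inj₁ y<x

≰ᵗ⇒> : ∀ {x y} → ¬ x ≤ᵗ y → y <ᵗ x
≰ᵗ⇒> x≰y with ≮ᵗ⇒≥ (x≰y ∘ inj₁)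
... | inj₁ y<x  = y<x
... | inj₂ refl = ⊥-elim (x≰y ≤ᵗ-refl)

≤ᵗ⇒≯ : ∀ {x y} → x ≤ᵗ y → ¬ y <ᵗ x
≤ᵗ⇒≯ (inj₁ x<y)  y<x = <ᵗ-irrefl (<ᵗ-trans x<y y<x)
≤ᵗ⇒≯ (inj₂ refl) x<x = <ᵗ-irrefl x<x

𝟎≤ᵗ : ∀ {x} → 𝟎 ≤ᵗ x
𝟎≤ᵗ {𝟎}        = ≤ᵗ-refl
𝟎≤ᵗ {ω^ a + b} = inj₁ <-zero

≮𝟎 : ∀ {x} → ¬ x <ᵗ 𝟎
≮𝟎 ()

≤ᵗ𝟎⇒≡𝟎 : ∀ {x} → x ≤ᵗ 𝟎 → x ≡ 𝟎
≤ᵗ𝟎⇒≡𝟎 (inj₂ x≡𝟎) = x≡𝟎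

snoc : Tm → Tm → Tm
snoc 𝟎          e = ω^ e + 𝟎
snoc (ω^ a + b) e = ω^ a + snoc b e

data SnocView : Tm → Set where
  []  : SnocView 𝟎
  _▸_ : ∀ {p e} → SnocView p → SnocView e → SnocView (snoc p e)

snocView : ∀ x → SnocView x
snocView 𝟎          = []
snocView (ω^ a + b) = prepend (snocView a) (snocView b)
  where
  prepend : ∀ {a b} → SnocView a → SnocView b → SnocView (ω^ a + b)
  prepend va []        = [] ▸ va
  prepend va (vp ▸ ve) = prepend va vp ▸ ve

ℓ-snoc : ∀ p e → ℓ (snoc p e) ≡ e
ℓ-snoc 𝟎                   e = refl
ℓ-snoc (ω^ a + 𝟎)          e = refl
ℓ-snoc (ω^ a + (ω^ c + d)) e = ℓ-snoc (ω^ c + d) e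

<-snoc : ∀ p e → p <ᵗ snoc p e
<-snoc 𝟎          e = <-zero
<-snoc (ω^ a + b) e = <-tail (<-snoc b e)

𝟎-or-snoc : ∀ x → x ≡ 𝟎 ⊎ Σ Tm λ p → Σ Tm λ e → x ≡ snoc p e
𝟎-or-snoc x with snocView x
... | []                  = inj₁ refl
... | _▸_ {p} {e} _ _ = inj₂ (p , e , refl)

snoc≢𝟎 : ∀ {p e} → snoc p e ≢ 𝟎
snoc≢𝟎 {𝟎}        ()
snoc≢𝟎 {ω^ a + b} ()

_≤ᵗ?_ : ∀ x y → Dec (x ≤ᵗ y)
_≤ᵗ?_ = NonStrict.decidable′ <ᵗ-cmp

ω^+-monoʳ-≤ᵗ : ∀ {a b d} → b ≤ᵗ d → (ω^ a + b) ≤ᵗ (ω^ a + d)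
ω^+-monoʳ-≤ᵗ (inj₁ b<d)  = inj₁ (<-tail b<d)
ω^+-monoʳ-≤ᵗ (inj₂ refl) = ≤ᵗ-refl

lead : Tm → Tm
lead 𝟎          = 𝟎
lead (ω^ a + b) = a

exp<ω^+ : ∀ a b → a <ᵗ (ω^ a + b)
exp<ω^+ 𝟎          b = <-zero
exp<ω^+ (ω^ c + d) b = <-exp (exp<ω^+ c d)

cnf-exp : ∀ {a b} → IsCNF (ω^ a + b) → IsCNF a
cnf-exp (cnf-1 ca)     = ca
cnf-exp (cnf-+ ca _ _) = ca

cnf-tail : ∀ {a b} → IsCNF (ω^ a + b) → IsCNF b
cnf-tail (cnf-1 _)      = cnf-0
cnf-tail (cnf-+ _ cb _) = cb

cnf-lead : ∀ {a b} → IsCNF (ω^ a + b) → lead b ≤ᵗ a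
cnf-lead (cnf-1 _)      = 𝟎≤ᵗ
cnf-lead (cnf-+ _ _ le) = le

cnf-ω^+ : ∀ {a x} → IsCNF a → IsCNF x → lead x ≤ᵗ a → IsCNF (ω^ a + x)
cnf-ω^+ ca cnf-0            _  = cnf-1 ca
cnf-ω^+ ca cx@(cnf-1 _)     le = cnf-+ ca cx le
cnf-ω^+ ca cx@(cnf-+ _ _ _) le = cnf-+ ca cx le

cnf-ℓ : ∀ {x} → IsCNF x → IsCNF (ℓ x)
cnf-ℓ cnf-0           = cnf-0
cnf-ℓ (cnf-1 ca)      = ca
cnf-ℓ (cnf-+ _ cx′ _) = cnf-ℓ cx′

ℓ≤lead : ∀ {x} → IsCNF x → ℓ x ≤ᵗ lead x
ℓ≤lead cnf-0            = ≤ᵗ-refl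
ℓ≤lead (cnf-1 _)        = ≤ᵗ-refl
ℓ≤lead (cnf-+ _ cx′ le) = ≤ᵗ-trans (ℓ≤lead cx′) le

ℓ<self : ∀ {a b} → IsCNF (ω^ a + b) → ℓ (ω^ a + b) <ᵗ (ω^ a + b)
ℓ<self {a} {b} cx = ≤-<ᵗ-trans (ℓ≤lead cx) (exp<ω^+ a b)

cnf-snoc⁻¹ : ∀ p {e} → IsCNF (snoc p e) → IsCNF p × IsCNF e
cnf-snoc⁻¹ 𝟎                   (cnf-1 ce)              = cnf-0 , ce
cnf-snoc⁻¹ (ω^ a + 𝟎)          (cnf-+ ca (cnf-1 ce) _) = cnf-1 ca , ce
cnf-snoc⁻¹ (ω^ a + (ω^ c + d)) (cnf-+ ca cx le)        =
  let cp , ce = cnf-snoc⁻¹ (ω^ c + d) cx in cnf-+ ca cp le , ce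

cnf-snoc𝟎 : ∀ {x} → IsCNF x → IsCNF (snoc x 𝟎)
cnf-snoc𝟎 cnf-0            = cnf-1 cnf-0
cnf-snoc𝟎 (cnf-1 ca)       = cnf-+ ca (cnf-1 cnf-0) 𝟎≤ᵗ
cnf-snoc𝟎 (cnf-+ ca cx le) = cnf-+ ca (cnf-snoc𝟎 cx) le

snoc-≤ : ∀ p e {s} → IsCNF s → p <ᵗ s → e ≤ᵗ ℓ s → snoc p e ≤ᵗ s
snoc-≤ 𝟎 e {ω^ c + 𝟎} _ <-zero (inj₁ e<c)  = inj₁ (<-exp e<c)
snoc-≤ 𝟎 e {ω^ c + 𝟎} _ <-zero (inj₂ refl) = ≤ᵗ-refl
snoc-≤ 𝟎 e {ω^ c + (ω^ c′ + d)} cs <-zero e≤ℓs with ≤ᵗ-trans e≤ℓs (ℓ≤lead cs)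
... | inj₁ e<c  = inj₁ (<-exp e<c)
... | inj₂ refl = inj₁ (<-tail <-zero)
snoc-≤ (ω^ a + b) e cs (<-exp a<c)  _    = inj₁ (<-exp a<c)
snoc-≤ (ω^ a + b) e {ω^ .a + (ω^ c + d)} cs (<-tail b<d) e≤ℓs =
  ω^+-monoʳ-≤ᵗ (snoc-≤ b e (cnf-tail cs) b<d e≤ℓs)

snoc-between : ∀ p r {e f} → IsCNF (snoc r f) →
               p <ᵗ snoc r f → snoc r f <ᵗ snoc p e → p ≤ᵗ r × f <ᵗ e
snoc-between 𝟎 𝟎 _ _ (<-exp f<e) = ≤ᵗ-refl , f<e
snoc-between 𝟎 r@(ω^ c + _) {f = f} cz _ (<-exp c<e) =
  𝟎≤ᵗ , ≤-<ᵗ-trans (subst (_≤ᵗ c) (ℓ-snoc r f) (ℓ≤lead cz)) c<e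
snoc-between (ω^ a + b) 𝟎 _ (<-exp a<f) (<-exp f<a) = ⊥-elim (<ᵗ-irrefl (<ᵗ-trans a<f f<a))
snoc-between (ω^ a + b) 𝟎 _ (<-exp a<a) (<-tail _)  = ⊥-elim (<ᵗ-irrefl a<a)
snoc-between (ω^ a + b) (ω^ c + r) _ (<-exp a<c) (<-exp c<a) = ⊥-elim (<ᵗ-irrefl (<ᵗ-trans a<c c<a))
snoc-between (ω^ a + b) (ω^ c + r) _ (<-exp a<a) (<-tail _)  = ⊥-elim (<ᵗ-irrefl a<a)
snoc-between (ω^ a + b) (ω^ c + r) _ (<-tail _)  (<-exp a<a) = ⊥-elim (<ᵗ-irrefl a<a)
snoc-between (ω^ a + b) (ω^ c + r) cz (<-tail p<z) (<-tail z<y) =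
  let b≤r , f<e = snoc-between b r (cnf-tail cz) p<z z<y in ω^+-monoʳ-≤ᵗ b≤r , f<e

-- snoc (keep m u) m is the least ordinal above u whose last exponent is m.
keep : Tm → Tm → Tm
keep m 𝟎 = 𝟎
keep m (ω^ a + b) with m ≤ᵗ? a
... | yes _ = ω^ a + keep m b
... | no  _ = 𝟎

keep-≤ : ∀ m u → keep m u ≤ᵗ u
keep-≤ m 𝟎 = ≤ᵗ-refl
keep-≤ m (ω^ a + b) with m ≤ᵗ? a
... | yes _ = ω^+-monoʳ-≤ᵗ (keep-≤ m b)
... | no  _ = 𝟎≤ᵗ

<-snoc-keep : ∀ m u → u <ᵗ snoc (keep m u) m
<-snoc-keep m 𝟎 = <-zero
<-snoc-keep m (ω^ a + b) with m ≤ᵗ? a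
... | yes _   = <-tail (<-snoc-keep m b)
... | no  m≰a = <-exp (≰ᵗ⇒> m≰a)

cnf-snoc-keep : ∀ {m u} → IsCNF m → IsCNF u → IsCNF (snoc (keep m u) m)
cnf-snoc-keep cm cnf-0 = cnf-1 cm
cnf-snoc-keep {m} {ω^ a + b} cm cu with m ≤ᵗ? a
... | yes m≤a = cnf-ω^+ (cnf-exp cu) (cnf-snoc-keep cm (cnf-tail cu)) (lead≤ b (cnf-lead cu))
  where
  lead≤ : ∀ b → lead b ≤ᵗ a → lead (snoc (keep m b) m) ≤ᵗ a
  lead≤ 𝟎 _ = m≤a
  lead≤ (ω^ c + d) c≤a with m ≤ᵗ? c
  ... | yes _ = c≤a
  ... | no  _ = m≤a
... | no  _ = cnf-1 cm

chain : Tm → ℕ → Tm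
chain x zero    = x
chain x (suc i) = chain (ℓ x) i

ℓ-chain : ∀ x i → ℓ (chain x i) ≡ chain x (suc i)
ℓ-chain x zero    = refl
ℓ-chain x (suc i) = ℓ-chain (ℓ x) i

chain-snoc : ∀ p e i → chain (snoc p e) (suc i) ≡ chain e i
chain-snoc p e i = cong (λ x → chain x i) (ℓ-snoc p e)

chain-𝟎 : ∀ i → chain 𝟎 i ≡ 𝟎
chain-𝟎 zero    = refl
chain-𝟎 (suc i) = chain-𝟎 i

cnf-chain : ∀ {x} → IsCNF x → ∀ i → IsCNF (chain x i)
cnf-chain cx zero    = cx
cnf-chain cx (suc i) = cnf-chain (cnf-ℓ cx) i

snoc-≤-chain : ∀ {x p e} i → IsCNF x → p <ᵗ chain x i → e ≤ᵗ chain x (suc i) → snoc p e ≤ᵗ chain x i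
snoc-≤-chain {x} {p} {e} i cx p< e≤ =
  snoc-≤ p e (cnf-chain cx i) p< (subst (e ≤ᵗ_) (sym (ℓ-chain x i)) e≤)

chainI : ∀ {x} → IsCNF x → ISeq
chainI {x} cx = iseq (λ i → ord (chain x i) (cnf-chain cx i)) (λ i → inj₂ (sym (ℓ-chain x i)))

⌊_⌋ : ISeq → ℕ → Tm
⌊ β ⌋ i = tm (seq β i)

infix 4 _≤ₚ_
_≤ₚ_ : (ℕ → Tm) → (ℕ → Tm) → Set
f ≤ₚ g = ∀ i → f i ≤ᵗ g i

Above : Tm → ISet
Above x β = chain x ≤ₚ ⌊ β ⌋

Above-𝟎 : ∀ β → Above 𝟎 β
Above-𝟎 β i = subst (_≤ᵗ ⌊ β ⌋ i) (sym (chain-𝟎 i)) 𝟎≤ᵗ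

tail : ISeq → ISeq
tail β = iseq (seq β ∘ suc) (wf β ∘ suc)

cons : (b : Ord) (δ : ISeq) → ⌊ δ ⌋ 0 ≤ᵗ ℓ (tm b) → ISeq
cons b δ δ₀≤ℓb = iseq s w
  where
  s : ℕ → Ord
  s zero    = b
  s (suc i) = seq δ i
  w : ∀ i → tm (s (suc i)) ≤ᵗ ℓ (tm (s i))
  w zero    = δ₀≤ℓb
  w (suc i) = wf δ i

R-tail⇒≤ℓ : ∀ n β δ → R n (tail β) δ → ⌊ δ ⌋ 0 ≤ᵗ ℓ (⌊ β ⌋ 0)
R-tail⇒≤ℓ zero    β δ (_ , δ₀<β₁)   = inj₁ (<-≤ᵗ-trans δ₀<β₁ (wf β 0))
R-tail⇒≤ℓ (suc n) β δ (β₁≡δ₀ , _) = subst (_≤ᵗ ℓ (⌊ β ⌋ 0)) (β₁≡δ₀ 0 (s≤s z≤n)) (wf β 0)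

cons-R : ∀ n β δ → R n (tail β) δ → ISeq
cons-R n β δ r = cons (seq β 0) δ (R-tail⇒≤ℓ n β δ r)

R-cons : ∀ n β δ (r : R n (tail β) δ) → R (suc n) β (cons-R n β δ r)
R-cons n β δ (agree , lt) = (λ { zero _ → refl ; (suc i) (s≤s i<n) → agree i i<n }) , lt

splice : ∀ m β γ → ⌊ γ ⌋ m <ᵗ ⌊ β ⌋ m →
         Σ ISeq λ δ → R m β δ × (∀ {i} → m ≤ℕ i → ⌊ δ ⌋ i ≡ ⌊ γ ⌋ i)
splice zero    β γ lt = γ , ((λ _ ()) , lt) , λ _ → refl
splice (suc m) β γ lt =
  let δ , r , above = splice m (tail β) (tail γ) lt
  in cons-R m β δ r , R-cons m β δ r , λ { (s≤s m≤i) → above m≤i }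

Mod : Fm → ISet
Mod A β = β ⊩ A

≐I-refl : ∀ {K} → K ≐I K
≐I-refl = (λ _ h → h) , (λ _ h → h)

≐I-sym : ∀ {K L} → K ≐I L → L ≐I K
≐I-sym (K⊆L , L⊆K) = L⊆K , K⊆L

≐I-trans : ∀ {K L M} → K ≐I L → L ≐I M → K ≐I M
≐I-trans (K⊆L , L⊆K) (L⊆M , M⊆L) = (λ β → L⊆M β ∘ K⊆L β) , (λ β → L⊆K β ∘ M⊆L β)

≐I-tail : ∀ {K L} → K ≐I L → (K ∘ tail) ≐I (L ∘ tail)
≐I-tail (K⊆L , L⊆K) = K⊆L ∘ tail , L⊆K ∘ tail

≐I-× : ∀ {K K′ L L′ : ISet} → K ≐I K′ → L ≐I L′ → (λ β → K β × L β) ≐I (λ β → K′ β × L′ β)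
≐I-× (K⊆ , ⊆K) (L⊆ , ⊆L) =
  (λ β (k , l) → K⊆ β k , L⊆ β l) , (λ β (k , l) → ⊆K β k , ⊆L β l)

↑ : Fm → Fm
↑ ⊤'      = ⊤'
↑ (A ∧ B) = ↑ A ∧ ↑ B
↑ (◇ n A) = ◇ (suc n) (↑ A)

↑-mono-⊢ : ∀ {A B} → A ⊢ B → ↑ A ⊢ ↑ B
↑-mono-⊢ ax         = ax
↑-mono-⊢ top        = top
↑-mono-⊢ ∧-el       = ∧-el
↑-mono-⊢ ∧-er       = ∧-er
↑-mono-⊢ (cut p q)  = cut (↑-mono-⊢ p) (↑-mono-⊢ q)
↑-mono-⊢ (∧-i p q)  = ∧-i (↑-mono-⊢ p) (↑-mono-⊢ q)
↑-mono-⊢ (◇-mono p) = ◇-mono (↑-mono-⊢ p)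
↑-mono-⊢ trans4     = trans4
↑-mono-⊢ (mono m<n) = mono (s≤s m<n)
↑-mono-⊢ (J m<n)    = J (s≤s m<n)

Mod-↑ : ∀ A → Mod (↑ A) ≐I (Mod A ∘ tail)
Mod-↑ ⊤'      = ≐I-refl
Mod-↑ (A ∧ B) =
  (λ β (a , b) → proj₁ (Mod-↑ A) β a , proj₁ (Mod-↑ B) β b) ,
  (λ β (a , b) → proj₂ (Mod-↑ A) β a , proj₂ (Mod-↑ B) β b)
Mod-↑ (◇ n A) =
  (λ { β (γ , (agree , lt) , γ⊩↑A) →
         tail γ , ((λ i i<n → agree (suc i) (s≤s i<n)) , lt) , proj₁ (Mod-↑ A) γ γ⊩↑A }) ,
  (λ { β (δ , r , δ⊩A) → cons-R n β δ r , R-cons n β δ r , proj₂ (Mod-↑ A) (cons-R n β δ r) δ⊩A })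

◇Above : ℕ → Tm → ISet
◇Above m x β = (∀ i → i <ℕ m → chain x i ≤ᵗ ⌊ β ⌋ i) × chain x m <ᵗ ⌊ β ⌋ m

Mod-◇ : ∀ {A x} → IsCNF x → Mod A ≐I Above x → ∀ m → Mod (◇ m A) ≐I ◇Above m x
Mod-◇ {A} {x} cx (A⊆ , ⊆A) m = to , from
  where
  to : Mod (◇ m A) ⊆I ◇Above m x
  to β (δ , (agree , δₘ<βₘ) , δ⊩A) =
    (λ i i<m → subst (chain x i ≤ᵗ_) (sym (agree i i<m)) (A⊆ δ δ⊩A i)) ,
    ≤-<ᵗ-trans (A⊆ δ δ⊩A m) δₘ<βₘ
  from : ◇Above m x ⊆I Mod (◇ m A)
  from β (below , xₘ<βₘ) = δ , r , ⊆A δ above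
    where
    spliced = splice m β (chainI cx) xₘ<βₘ
    δ = proj₁ spliced
    r = proj₁ (proj₂ spliced)
    above : Above x δ
    above i with i ℕ.<? m
    ... | yes i<m = subst (chain x i ≤ᵗ_) (proj₁ r i i<m) (below i i<m)
    ... | no  i≮m = inj₂ (sym (proj₂ (proj₂ spliced) (ℕ.≮⇒≥ i≮m)))

Mod-◇₀ : ∀ {A x} → IsCNF x → Mod A ≐I Above x → Mod (◇ 0 A) ≐I λ β → x <ᵗ ⌊ β ⌋ 0
Mod-◇₀ cx A≐ = ≐I-trans (Mod-◇ cx A≐ 0) ((λ _ → proj₂) , (λ _ x<β₀ → (λ _ ()) , x<β₀))

Above-snoc : ∀ p e → Above (snoc p e) ≐I λ β → Above e (tail β) × p <ᵗ ⌊ β ⌋ 0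
Above-snoc p e = to , from
  where
  to : Above (snoc p e) ⊆I λ β → Above e (tail β) × p <ᵗ ⌊ β ⌋ 0
  to β above = (λ i → subst (_≤ᵗ ⌊ β ⌋ (suc i)) (chain-snoc p e i) (above (suc i))) ,
               <-≤ᵗ-trans (<-snoc p e) (above 0)
  from : (λ β → Above e (tail β) × p <ᵗ ⌊ β ⌋ 0) ⊆I Above (snoc p e)
  from β (above , p<β₀) zero    = snoc-≤ p e (cnf (seq β 0)) p<β₀ (≤ᵗ-trans (above 0) (wf β 0))
  from β (above , p<β₀) (suc i) = subst (_≤ᵗ ⌊ β ⌋ (suc i)) (sym (chain-snoc p e i)) (above i)

-- Worms

W : Tm → Fm
-- W x with B in place of its innermost ⊤'
W[_] : Tm → Fm → Fm

W x = W[ x ] ⊤'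

W[ 𝟎 ]        B = B
W[ ω^ a + b ] B = W[ b ] (↑ (W a) ∧ ◇ 0 B)

W-snoc : ∀ p e → W (snoc p e) ≡ ↑ (W e) ∧ ◇ 0 (W p)
W-snoc p e = go p ⊤'
  where
  go : ∀ p B → W[ snoc p e ] B ≡ ↑ (W e) ∧ ◇ 0 (W[ p ] B)
  go 𝟎          B = refl
  go (ω^ a + b) B = go b _

W-snoc⊢↑W : ∀ p e → W (snoc p e) ⊢ ↑ (W e)
W-snoc⊢↑W p e = subst (_⊢ ↑ (W e)) (sym (W-snoc p e)) ∧-el

Mod-↑∧◇₀ : ∀ {A B e p} → IsCNF p → Mod A ≐I Above e → Mod B ≐I Above p →
           Mod (↑ A ∧ ◇ 0 B) ≐I λ β → Above e (tail β) × p <ᵗ ⌊ β ⌋ 0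
Mod-↑∧◇₀ {A} cp A≐ B≐ = ≐I-× (≐I-trans (Mod-↑ A) (≐I-tail A≐)) (Mod-◇₀ cp B≐)

Mod-W : ∀ {x} → IsCNF x → Mod (W x) ≐I Above x
Mod-W {x} = go (snocView x)
  where
  go : ∀ {x} → SnocView x → IsCNF x → Mod (W x) ≐I Above x
  go []                    _  = (λ β _ → Above-𝟎 β) , (λ _ _ → tt)
  go (_▸_ {p} {e} vp ve) cx rewrite W-snoc p e =
    let cp , ce = cnf-snoc⁻¹ p cx
    in ≐I-trans (Mod-↑∧◇₀ cp (go ve ce) (go vp cp)) (≐I-sym (Above-snoc p e))

∧-cong : ∀ {A A′ B B′} → A ⊢ A′ → B ⊢ B′ → A ∧ B ⊢ A′ ∧ B′
∧-cong p q = ∧-i (cut ∧-el p) (cut ∧-er q)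

⊢◇-trans : ∀ {n A B C} → A ⊢ ◇ n B → B ⊢ ◇ n C → A ⊢ ◇ n C
⊢◇-trans p q = cut p (cut (◇-mono q) trans4)

W-◇₀ : ∀ {y z} → IsCNF y → IsCNF z → z <ᵗ y → W y ⊢ ◇ 0 (W z)
W-◇₀ {y} = go (snocView y)
  where
  go : ∀ {y z} → SnocView y → IsCNF y → IsCNF z → z <ᵗ y → W y ⊢ ◇ 0 (W z)
  go [] _ _ ()
  go {z = z} (_▸_ {p} {e} vp ve) cy cz z<y rewrite W-snoc p e with <ᵗ-cmp z p
  ... | tri< z<p _ _ = ⊢◇-trans ∧-er (go vp cp cz z<p)
    where cp = proj₁ (cnf-snoc⁻¹ p cy)
  ... | tri≈ _ refl _ = ∧-er
  ... | tri> _ _ p<z = between (snocView z) cz p<z z<y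
    where
    cp = proj₁ (cnf-snoc⁻¹ p cy)
    ce = proj₂ (cnf-snoc⁻¹ p cy)
    -- ◇₁ ↑W f ∧ ◇₀ W r  ⊢  ◇₁ (↑W f ∧ ◇₀ W r)  ⊢  ◇₀ W (snoc r f), by J and mono
    between : ∀ {z} → SnocView z → IsCNF z → p <ᵗ z → z <ᵗ snoc p e →
              ↑ (W e) ∧ ◇ 0 (W p) ⊢ ◇ 0 (W z)
    between (_▸_ {r} {f} vr _) cz p<z z<y rewrite W-snoc r f =
      cut (∧-i (cut ∧-el (↑-mono-⊢ (go ve ce cf f<e))) ⊢◇₀Wr) (cut (J (s≤s z≤n)) (mono (s≤s z≤n)))
      where
      cr = proj₁ (cnf-snoc⁻¹ r cz)
      cf = proj₂ (cnf-snoc⁻¹ r cz)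
      p≤r×f<e = snoc-between p r cz p<z z<y
      f<e = proj₂ p≤r×f<e
      ⊢◇₀Wr : ↑ (W e) ∧ ◇ 0 (W p) ⊢ ◇ 0 (W r)
      ⊢◇₀Wr with proj₁ p≤r×f<e
      ... | inj₂ refl = ∧-er
      ... | inj₁ p<r  = between vr cr p<r (<ᵗ-trans (<-snoc r f) z<y)

infix 4 _≅_
record _≅_ (A B : Fm) : Set where
  constructor mk≅
  field
    ⊢-to   : A ⊢ B
    ⊢-from : B ⊢ A
    ⊩-iff  : Mod A ≐I Mod B
open _≅_

≅-refl : ∀ {A} → A ≅ A
≅-refl = mk≅ ax ax ≐I-refl

≅-sym : ∀ {A B} → A ≅ B → B ≅ A
≅-sym (mk≅ to from iff) = mk≅ from to (≐I-sym iff)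

≅-trans : ∀ {A B C} → A ≅ B → B ≅ C → A ≅ C
≅-trans (mk≅ to from iff) (mk≅ to′ from′ iff′) = mk≅ (cut to to′) (cut from′ from) (≐I-trans iff iff′)

≡⇒≅ : ∀ {A B} → A ≡ B → A ≅ B
≡⇒≅ refl = ≅-refl

∧-≅ : ∀ {A A′ B B′} → A ≅ A′ → B ≅ B′ → A ∧ B ≅ A′ ∧ B′
∧-≅ (mk≅ to from iff) (mk≅ to′ from′ iff′) = mk≅ (∧-cong to to′) (∧-cong from from′) (≐I-× iff iff′)

◇-≅ : ∀ {n A B} → A ≅ B → ◇ n A ≅ ◇ n B
◇-≅ (mk≅ to from (A⊆B , B⊆A)) = mk≅ (◇-mono to) (◇-mono from)
  ((λ β (γ , r , γ⊩A) → γ , r , A⊆B γ γ⊩A) , (λ β (γ , r , γ⊩B) → γ , r , B⊆A γ γ⊩B))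

↑-≅ : ∀ {A B} → A ≅ B → ↑ A ≅ ↑ B
↑-≅ {A} {B} (mk≅ to from iff) = mk≅ (↑-mono-⊢ to) (↑-mono-⊢ from)
  (≐I-trans (Mod-↑ A) (≐I-trans (≐I-tail iff) (≐I-sym (Mod-↑ B))))

∧-absorb-≅ : ∀ {A B} → A ⊢ B → Mod A ⊆I Mod B → A ∧ B ≅ A
∧-absorb-≅ A⊢B A⊨B = mk≅ ∧-el (∧-i ax A⊢B) ((λ _ → proj₁) , (λ β β⊩A → β⊩A , A⊨B β β⊩A))

∧-comm-≅ : ∀ {A B} → A ∧ B ≅ B ∧ A
∧-comm-≅ = mk≅ (∧-i ∧-er ∧-el) (∧-i ∧-er ∧-el) ((λ _ (a , b) → b , a) , (λ _ (b , a) → a , b))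

∧-interchange-≅ : ∀ {A B C D} → (A ∧ B) ∧ (C ∧ D) ≅ (A ∧ C) ∧ (B ∧ D)
∧-interchange-≅ = mk≅ swap swap
  ((λ _ ((a , b) , (c , d)) → (a , c) , (b , d)) , (λ _ ((a , c) , (b , d)) → (a , b) , (c , d)))
  where
  swap : ∀ {A B C D} → (A ∧ B) ∧ (C ∧ D) ⊢ (A ∧ C) ∧ (B ∧ D)
  swap = ∧-i (∧-cong ∧-el ∧-el) (∧-cong ∧-er ∧-er)

⊤∧-≅ : ∀ {A} → ⊤' ∧ A ≅ A
⊤∧-≅ = mk≅ ∧-er (∧-i top ax) ((λ _ → proj₂) , (λ _ h → tt , h))

◇∧◇₀-≅ : ∀ {n A B} → ◇ (suc n) (A ∧ ◇ 0 B) ≅ ◇ (suc n) A ∧ ◇ 0 B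
◇∧◇₀-≅ = mk≅ (∧-i (◇-mono ∧-el) (cut (◇-mono ∧-er) (cut (mono (s≤s z≤n)) trans4))) (J (s≤s z≤n))
  ((λ { β (γ , (agree , lt) , γ⊩A , (δ , (_ , δ₀<γ₀) , δ⊩B)) →
         (γ , (agree , lt) , γ⊩A) ,
         (δ , ((λ _ ()) , subst (_ <ᵗ_) (sym (agree 0 (s≤s z≤n))) δ₀<γ₀) , δ⊩B) }) ,
   (λ { β ((γ , (agree , lt) , γ⊩A) , (δ , (_ , δ₀<β₀) , δ⊩B)) →
         γ , (agree , lt) , γ⊩A , (δ , ((λ _ ()) , subst (_ <ᵗ_) (agree 0 (s≤s z≤n)) δ₀<β₀) , δ⊩B) }))

HasWormNF : Fm → Set
HasWormNF A = Σ Tm λ x → IsCNF x × A ≅ W x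

◇₀W-mono : ∀ {p q} → IsCNF p → IsCNF q → q ≤ᵗ p → ◇ 0 (W p) ⊢ ◇ 0 (W q)
◇₀W-mono cp cq (inj₁ q<p) = ⊢◇-trans ax (W-◇₀ cp cq q<p)
◇₀W-mono cp cq (inj₂ refl) = ax

◇₀W-absorb-≅ : ∀ {p q} → IsCNF p → IsCNF q → q ≤ᵗ p → ◇ 0 (W p) ∧ ◇ 0 (W q) ≅ ◇ 0 (W p)
◇₀W-absorb-≅ {p} {q} cp cq q≤p = ∧-absorb-≅ (◇₀W-mono cp cq q≤p) sem
  where
  sem : Mod (◇ 0 (W p)) ⊆I Mod (◇ 0 (W q))
  sem β β⊩ = proj₂ (Mod-◇₀ cq (Mod-W cq)) β (≤-<ᵗ-trans q≤p (proj₁ (Mod-◇₀ cp (Mod-W cp)) β β⊩))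

↑W∧◇₀W-≅ : ∀ {m u} → IsCNF m → IsCNF u → ↑ (W m) ∧ ◇ 0 (W u) ≅ W (snoc (keep m u) m)
↑W∧◇₀W-≅ {m} {u} cm cu = mk≅ to from (≐I-trans (Mod-↑∧◇₀ cu (Mod-W cm) (Mod-W cu))
  (≐I-trans raise (≐I-trans (≐I-sym (Above-snoc k m)) (≐I-sym (Mod-W cz)))))
  where
  k  = keep m u
  cz = cnf-snoc-keep cm cu
  ck = proj₁ (cnf-snoc⁻¹ k cz)
  to : ↑ (W m) ∧ ◇ 0 (W u) ⊢ W (snoc k m)
  to rewrite W-snoc k m = ∧-cong ax (◇₀W-mono cu ck (keep-≤ m u))
  from : W (snoc k m) ⊢ ↑ (W m) ∧ ◇ 0 (W u)
  from = ∧-i (W-snoc⊢↑W k m) (W-◇₀ cz cu (<-snoc-keep m u))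
  -- Once m ≤ β₁ ≤ ℓ β₀, the ordinal u lies below β₀ iff its m-prefix k does.
  raise : (λ β → Above m (tail β) × u <ᵗ ⌊ β ⌋ 0) ≐I (λ β → Above m (tail β) × k <ᵗ ⌊ β ⌋ 0)
  raise = (λ β (above , u<β₀) → above , ≤-<ᵗ-trans (keep-≤ m u) u<β₀) ,
          (λ β (above , k<β₀) → above , <-≤ᵗ-trans (<-snoc-keep m u)
             (snoc-≤ k m (cnf (seq β 0)) k<β₀ (≤ᵗ-trans (above 0) (wf β 0))))

W∧W-nf : ∀ {x y} → IsCNF x → IsCNF y → HasWormNF (W x ∧ W y)
W∧W-nf {x} = go (snocView x)
  where
  go : ∀ {x y} → SnocView x → IsCNF x → IsCNF y → HasWormNF (W x ∧ W y)
  go {y = y} [] _ cy = y , cy , ⊤∧-≅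
  go {x} {y} (_▸_ {p} {e} vp ve) cx cy with snocView y
  ... | [] = x , cx , ≅-trans ∧-comm-≅ ⊤∧-≅
  ... | _▸_ {q} {f} _ _ =
    let cp , ce = cnf-snoc⁻¹ p cx
        cq , cf = cnf-snoc⁻¹ q cy
        m , cm , We∧Wf≅Wm = go ve ce cf
        u , cu , ◇₀Wp∧◇₀Wq≅◇₀Wu = ◇₀-max cp cq
    in snoc (keep m u) m , cnf-snoc-keep cm cu ,
       ≅-trans (∧-≅ (≡⇒≅ (W-snoc p e)) (≡⇒≅ (W-snoc q f)))
         (≅-trans ∧-interchange-≅
           (≅-trans (∧-≅ (↑-≅ We∧Wf≅Wm) ◇₀Wp∧◇₀Wq≅◇₀Wu) (↑W∧◇₀W-≅ cm cu)))
    where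
    ◇₀-max : ∀ {p q} → IsCNF p → IsCNF q → Σ Tm λ u → IsCNF u × ◇ 0 (W p) ∧ ◇ 0 (W q) ≅ ◇ 0 (W u)
    ◇₀-max {p} {q} cp cq with <ᵗ-cmp p q
    ... | tri< p<q _ _ = q , cq , ≅-trans ∧-comm-≅ (◇₀W-absorb-≅ cq cp (inj₁ p<q))
    ... | tri≈ _ p≡q _ = p , cp , ◇₀W-absorb-≅ cp cq (inj₂ (sym p≡q))
    ... | tri> _ _ q<p = p , cp , ◇₀W-absorb-≅ cp cq (inj₁ q<p)

↑W-nf : ∀ {m} → IsCNF m → HasWormNF (↑ (W m))
↑W-nf {m} cm with snocView m
... | [] = 𝟎 , cnf-0 , ≅-refl
... | _▸_ {p} {e} _ _ = snoc 𝟎 m , cnf-1 cm , ≅-sym (∧-absorb-≅ syn sem)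
  where
  syn : ↑ (W m) ⊢ ◇ 0 ⊤'
  syn = cut (↑-mono-⊢ (subst (_⊢ ◇ 0 ⊤') (sym (W-snoc p e)) (cut ∧-er (◇-mono top)))) (mono (s≤s z≤n))
  -- m ≤ β₁ ≤ ℓ β₀ forces β₀ ≠ 𝟎
  sem : Mod (↑ (W m)) ⊆I Mod (◇ 0 ⊤')
  sem β β⊩ = proj₂ (Mod-◇₀ cnf-0 (Mod-W cnf-0)) β (positive (⌊ β ⌋ 0) (≤ᵗ-trans m≤β₁ (wf β 0)))
    where
    m≤β₁ = proj₁ (Mod-W cm) (tail β) (proj₁ (Mod-↑ (W m)) β β⊩) 0
    positive : ∀ t → m ≤ᵗ ℓ t → 𝟎 <ᵗ t
    positive 𝟎 m≤𝟎 = ⊥-elim (snoc≢𝟎 (≤ᵗ𝟎⇒≡𝟎 m≤𝟎))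
    positive (ω^ _ + _) _ = <-zero

◇W-nf : ∀ n {x} → IsCNF x → HasWormNF (◇ n (W x))
◇W-nf zero {x} cx = snoc x 𝟎 , cnf-snoc𝟎 cx , ≅-sym (≅-trans (≡⇒≅ (W-snoc x 𝟎)) ⊤∧-≅)
◇W-nf (suc n) {x} cx with snocView x
... | [] =
  let m , cm , ◇ₙ⊤≅Wm = ◇W-nf n cnf-0
      z , cz , ↑Wm≅Wz = ↑W-nf cm
  in z , cz , ≅-trans (↑-≅ ◇ₙ⊤≅Wm) ↑Wm≅Wz
... | _▸_ {p} {e} _ _ =
  let cp , ce = cnf-snoc⁻¹ p cx
      m , cm , ◇ₙWe≅Wm = ◇W-nf n ce
  in snoc (keep m p) m , cnf-snoc-keep cm cp ,
     ≅-trans (◇-≅ (≡⇒≅ (W-snoc p e)))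
       (≅-trans ◇∧◇₀-≅ (≅-trans (∧-≅ (↑-≅ ◇ₙWe≅Wm) ≅-refl) (↑W∧◇₀W-≅ cm cp)))

wormNF : ∀ A → HasWormNF A
wormNF ⊤' = 𝟎 , cnf-0 , ≅-refl
wormNF (A ∧ B) =
  let x , cx , A≅Wx = wormNF A
      y , cy , B≅Wy = wormNF B
      z , cz , Wx∧Wy≅Wz = W∧W-nf cx cy
  in z , cz , ≅-trans (∧-≅ A≅Wx B≅Wy) Wx∧Wy≅Wz
wormNF (◇ n A) =
  let x , cx , A≅Wx = wormNF A
      z , cz , ◇Wx≅Wz = ◇W-nf n cx
  in z , cz , ≅-trans (◇-≅ A≅Wx) ◇Wx≅Wz

o : Fm → Tm
o A = proj₁ (wormNF A)

cnf-o : ∀ A → IsCNF (o A)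
cnf-o A = proj₁ (proj₂ (wormNF A))

≅W-o : ∀ A → A ≅ W (o A)
≅W-o A = proj₂ (proj₂ (wormNF A))

Mod≐Above : ∀ A → Mod A ≐I Above (o A)
Mod≐Above A = ≐I-trans (⊩-iff (≅W-o A)) (Mod-W (cnf-o A))

-- Soundness and completeness

chain-<-pred : ∀ x β k → chain x k ≤ᵗ ⌊ β ⌋ k → chain x (suc k) <ᵗ ⌊ β ⌋ (suc k) → chain x k <ᵗ ⌊ β ⌋ k
chain-<-pred x β k (inj₁ lt) _ = lt
chain-<-pred x β k (inj₂ eq) lt =
  ⊥-elim (≤ᵗ⇒≯ (subst (⌊ β ⌋ (suc k) ≤ᵗ_) (trans (cong ℓ (sym eq)) (ℓ-chain x k)) (wf β k)) lt)

◇Above-strict-≤ : ∀ {x β m n} → m ≤ℕ n → ◇Above n x β → chain x m <ᵗ ⌊ β ⌋ m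
◇Above-strict-≤ {n = zero} z≤n (_ , lt) = lt
◇Above-strict-≤ {x} {β} {m} {suc n} m≤1+n (below , lt) with ℕ.m≤n⇒m<n∨m≡n m≤1+n
... | inj₂ refl      = lt
... | inj₁ (s≤s m≤n) = ◇Above-strict-≤ {x} {β} m≤n
  ((λ i i<n → below i (ℕ.m<n⇒m<1+n i<n)) , chain-<-pred x β n (below n ℕ.≤-refl) lt)

◇Above-mono : ∀ {x m n} → m <ℕ n → ◇Above n x ⊆I ◇Above m x
◇Above-mono {x} m<n β h@(below , _) =
  (λ i i<m → below i (ℕ.<-trans i<m m<n)) , ◇Above-strict-≤ {x} {β} (ℕ.<⇒≤ m<n) h

sound : ∀ {A B} → A ⊢ B → Mod A ⊆I Mod B
sound ax         β h = h
sound top        β h = tt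
sound ∧-el       β h = proj₁ h
sound ∧-er       β h = proj₂ h
sound (cut p q)  β h = sound q β (sound p β h)
sound (∧-i p q)  β h = sound p β h , sound q β h
sound (◇-mono p) β (γ , r , h) = γ , r , sound p γ h
sound trans4     β (γ , (agree , lt) , δ , (agree′ , lt′) , h) =
  δ , ((λ i i<n → trans (agree i i<n) (agree′ i i<n)) , <ᵗ-trans lt′ lt) , h
sound (mono {m} {n} {A} m<n) β h =
  let ◇A≐ = Mod-◇ (cnf-o A) (Mod≐Above A)
  in proj₂ (◇A≐ m) β (◇Above-mono m<n β (proj₁ (◇A≐ n) β h))
sound (J {m} {n} m<n) β ((γ , (agree , lt) , ha) , (δ , (agree′ , lt′) , hb)) =
  γ , (agree , lt) , ha ,
  δ , ((λ i i<m → trans (sym (agree i (ℕ.<-trans i<m m<n))) (agree′ i i<m)) ,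
       subst (⌊ δ ⌋ m <ᵗ_) (agree m m<n) lt′) , hb

W-mono : ∀ {x y} → IsCNF x → IsCNF y → chain x ≤ₚ chain y → W y ⊢ W x
W-mono {x} = go (snocView x)
  where
  go : ∀ {x y} → SnocView x → IsCNF x → IsCNF y → chain x ≤ₚ chain y → W y ⊢ W x
  go [] _ _ _ = top
  go {y = y} (_▸_ {p} {e} vp ve) cx cy x≤y with snocView y
  ... | [] = ⊥-elim (snoc≢𝟎 (≤ᵗ𝟎⇒≡𝟎 (x≤y 0)))
  ... | _▸_ {q} {f} _ _ rewrite W-snoc p e =
    ∧-i (cut (W-snoc⊢↑W q f) (↑-mono-⊢ (go ve ce cf e≤f)))
        (W-◇₀ cy (proj₁ (cnf-snoc⁻¹ p cx)) (<-≤ᵗ-trans (<-snoc p e) (x≤y 0)))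
    where
    ce = proj₂ (cnf-snoc⁻¹ p cx)
    cf = proj₂ (cnf-snoc⁻¹ q cy)
    e≤f : chain e ≤ₚ chain f
    e≤f i = subst₂ _≤ᵗ_ (chain-snoc p e i) (chain-snoc q f i) (x≤y (suc i))

Mod-⊆⇒chain-≥ : ∀ {A B} → Mod A ⊆I Mod B → chain (o B) ≤ₚ chain (o A)
Mod-⊆⇒chain-≥ {A} {B} A⊨B = proj₁ (Mod≐Above B) w (A⊨B w (proj₂ (Mod≐Above A) w λ _ → ≤ᵗ-refl))
  where w = chainI (cnf-o A)

complete : ∀ {A B} → Mod A ⊆I Mod B → A ⊢ B
complete {A} {B} A⊨B =
  cut (⊢-to (≅W-o A)) (cut (W-mono (cnf-o B) (cnf-o A) (Mod-⊆⇒chain-≥ A⊨B)) (⊢-from (≅W-o B)))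

-- Well-foundedness

-- <ᵗ on arbitrary terms is not well founded: ω^1 > ω^0 + ω^1 > ω^0 + ω^0 + ω^1 > …
_<ᶜ_ : Tm → Tm → Set
x <ᶜ y = IsCNF x × x <ᵗ y

acc-𝟎 : Acc _<ᶜ_ 𝟎
acc-𝟎 = acc λ { (_ , ()) }

acc-lead≤ : ∀ {a} → Acc _<ᶜ_ a → ∀ {y} → IsCNF y → lead y ≤ᵗ a → Acc _<ᶜ_ y
acc-lead≤ {a} (acc rs) = go
  where
  mutual
    go : ∀ {y} → IsCNF y → lead y ≤ᵗ a → Acc _<ᶜ_ y
    go {𝟎}        _  _           = acc-𝟎
    go {ω^ c + d} cy (inj₁ c<a)  = acc-lead≤ (rs (cnf-exp cy , c<a)) cy ≤ᵗ-refl
    go {ω^ c + d} cy (inj₂ refl) = leading-a (go (cnf-tail cy) (cnf-lead cy)) cy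
    leading-a : ∀ {d} → Acc _<ᶜ_ d → IsCNF (ω^ a + d) → Acc _<ᶜ_ (ω^ a + d)
    leading-a (acc rd) _ = acc λ
      { (_  , <-zero)      → acc-𝟎
      ; (cz , <-exp c<a)   → acc-lead≤ (rs (cnf-exp cz , c<a)) cz ≤ᵗ-refl
      ; (cz , <-tail e<d)  → leading-a (rd (cnf-tail cz , e<d)) cz }

<ᶜ-acc : ∀ {x} → IsCNF x → Acc _<ᶜ_ x
<ᶜ-acc cnf-0 = acc-𝟎
<ᶜ-acc cx@(cnf-1 ca)     = acc-lead≤ (<ᶜ-acc ca) cx ≤ᵗ-refl
<ᶜ-acc cx@(cnf-+ ca _ _) = acc-lead≤ (<ᶜ-acc ca) cx ≤ᵗ-refl

module Classical (lem : ExcludedMiddle 0ℓ) where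

  least : ∀ (P : Tm → Set) {x} → IsCNF x → P x →
          Σ Tm λ m → IsCNF m × P m × (∀ {y} → IsCNF y → P y → m ≤ᵗ y)
  least P cx = go (<ᶜ-acc cx) cx
    where
    go : ∀ {x} → Acc _<ᶜ_ x → IsCNF x → P x → Σ Tm λ m → IsCNF m × P m × (∀ {y} → IsCNF y → P y → m ≤ᵗ y)
    go {x} (acc rs) cx px with lem {Σ Tm λ y → IsCNF y × P y × y <ᵗ x}
    ... | yes (y , cy , py , y<x) = go (rs (cy , y<x)) cy py
    ... | no  ∄smaller = x , cx , px , λ cy py → ≮ᵗ⇒≥ (λ y<x → ∄smaller (_ , cy , py , y<x))

eventually-𝟎 : ∀ β → ∃ λ K → ∀ {j} → K ≤ℕ j → ⌊ β ⌋ j ≡ 𝟎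
eventually-𝟎 β = go (<ᶜ-acc (cnf (seq β 0))) β refl
  where
  stays-𝟎 : ∀ β {j} → ⌊ β ⌋ 0 ≡ 𝟎 → ⌊ β ⌋ j ≡ 𝟎
  stays-𝟎 β {zero}  β₀≡𝟎 = β₀≡𝟎
  stays-𝟎 β {suc j} β₀≡𝟎 = ≤ᵗ𝟎⇒≡𝟎 (subst (λ t → ⌊ β ⌋ (suc j) ≤ᵗ ℓ t) (stays-𝟎 β β₀≡𝟎) (wf β j))
  go : ∀ {x} → Acc _<ᶜ_ x → ∀ β → ⌊ β ⌋ 0 ≡ x → ∃ λ K → ∀ {j} → K ≤ℕ j → ⌊ β ⌋ j ≡ 𝟎
  go {𝟎} _ β β₀≡𝟎 = 0 , λ _ → stays-𝟎 β β₀≡𝟎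
  go {ω^ a + b} (acc rs) β β₀≡x =
    let β₁<x = ≤-<ᵗ-trans (subst (λ t → ⌊ β ⌋ 1 ≤ᵗ ℓ t) β₀≡x (wf β 0))
                          (ℓ<self (subst IsCNF β₀≡x (cnf (seq β 0))))
        K , after-K = go (rs (cnf (seq β 1) , β₁<x)) (tail β) refl
    in suc K , λ { (s≤s K≤j) → after-K K≤j }

⊩-upward : ∀ B {α β} → ⌊ α ⌋ ≤ₚ ⌊ β ⌋ → α ⊩ B → β ⊩ B
⊩-upward B {α} {β} α≤β α⊩B =
  proj₂ (Mod≐Above B) β (λ i → ≤ᵗ-trans (proj₁ (Mod≐Above B) α α⊩B i) (α≤β i))

sep : ℕ → Tm → Fm
sep zero    u = ◇ 0 (W u)
sep (suc i) u = ↑ (sep i u)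

Mod-sep : ∀ i {u} → IsCNF u → Mod (sep i u) ≐I λ β → u <ᵗ ⌊ β ⌋ i
Mod-sep zero    cu = Mod-◇₀ cu (Mod-W cu)
Mod-sep (suc i) {u} cu = ≐I-trans (Mod-↑ (sep i u)) (≐I-tail (Mod-sep i cu))

⟦⟧-⊆⇒≥ : ∀ {α β} → ⟦ β ⟧ ⊆ ⟦ α ⟧ → ⌊ β ⌋ ≤ₚ ⌊ α ⌋
⟦⟧-⊆⇒≥ {α} {β} β⊆α i = ≮ᵗ⇒≥ λ αᵢ<βᵢ →
  <ᵗ-irrefl (proj₁ sepᵢ α (β⊆α _ (proj₂ sepᵢ β αᵢ<βᵢ)))
  where sepᵢ = Mod-sep i (cnf (seq α i))

⟦⟧-antitone : ∀ {α β} → α ≤I β → ⟦ α ⟧ ≤RC ⟦ β ⟧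
⟦⟧-antitone β≤α B β⊩B = ⊩-upward B β≤α β⊩B

⟦⟧-injective : ∀ {α β} → ⟦ α ⟧ ≐ ⟦ β ⟧ → α ≡I β
⟦⟧-injective (α⊆β , β⊆α) i = ≤ᵗ-antisym (⟦⟧-⊆⇒≥ α⊆β i) (⟦⟧-⊆⇒≥ β⊆α i)

⊩-conj : ∀ {β As} → All (β ⊩_) As → β ⊩ conj As
⊩-conj []       = tt
⊩-conj (h ∷ hs) = h , ⊩-conj hs

⟦⟧-isRCTheory : ∀ α → IsRCTheory ⟦ α ⟧
⟦⟧-isRCTheory α As B hs d = sound d α (⊩-conj hs)

lowerBound : ∀ α → Σ Fm λ F → Mod F ⊆I λ β → ⌊ α ⌋ ≤ₚ ⌊ β ⌋
lowerBound α = strictBelow K , above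
  where
  K = proj₁ (eventually-𝟎 α)
  strictBelow : ℕ → Fm
  strictBelow zero    = ⊤'
  strictBelow (suc k) = sep k (⌊ α ⌋ k) ∧ strictBelow k
  strict : ∀ k β → β ⊩ strictBelow k → ∀ i → i <ℕ k → ⌊ α ⌋ i <ᵗ ⌊ β ⌋ i
  strict (suc k) β (h , hs) i i<1+k with i ℕ.≟ k
  ... | yes refl = proj₁ (Mod-sep k (cnf (seq α k))) β h
  ... | no  i≢k  = strict k β hs i (ℕ.≤∧≢⇒< (ℕ.≤-pred i<1+k) i≢k)
  above : Mod (strictBelow K) ⊆I λ β → ⌊ α ⌋ ≤ₚ ⌊ β ⌋
  above β h i with i ℕ.<? K
  ... | yes i<K = inj₁ (strict K β h i i<K)
  ... | no  i≮K = subst (_≤ᵗ ⌊ β ⌋ i) (sym (proj₂ (eventually-𝟎 α) (ℕ.≮⇒≥ i≮K))) 𝟎≤ᵗ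

⟦⟧-bounded : ∀ α → Bounded ⟦ α ⟧
⟦⟧-bounded α = let F , F⊨α≤ = lowerBound α
               in F , λ B α⊩B → complete λ β β⊩F → ⊩-upward B (F⊨α≤ β β⊩F) α⊩B

⟦⟧-isBddTheory : ∀ α → IsBddTheory ⟦ α ⟧
⟦⟧-isBddTheory α = ⟦⟧-isRCTheory α , ⟦⟧-bounded α

-- Every bounded theory is some ⟦ α ⟧

module _ {T : FmSet} (thy : IsRCTheory T) where

  thy-⊤ : T ⊤'
  thy-⊤ = thy [] ⊤' [] ax

  thy-∧ : ∀ {B C} → T B → T C → T (B ∧ C)
  thy-∧ {B} {C} B∈T C∈T = thy (B ∷ C ∷ []) (B ∧ C) (B∈T ∷ C∈T ∷ []) (∧-i ∧-el (cut ∧-er ∧-el))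

  thy-⊢ : ∀ {B C} → T B → B ⊢ C → T C
  thy-⊢ {B} {C} B∈T B⊢C = thy (B ∷ []) C (B∈T ∷ []) (cut ∧-el B⊢C)

downward-induction : ∀ {P : ℕ → Set} K → (∀ {i} → K ≤ℕ i → P i) → (∀ i → P (suc i) → P i) → ∀ i → P i
downward-induction {P} K base step i = go K i (ℕ.m≤m+n K i)
  where
  go : ∀ d i → K ≤ℕ d + i → P i
  go zero    i K≤i = base K≤i
  go (suc d) i K≤ = step i (go d (suc i) (subst (K ≤ℕ_) (sym (ℕ.+-suc d i)) K≤))

-- The i-th entry of the witness is the supremum of the i-th entries chain (o B) i, B ∈ T.
module Supremum (lem : ExcludedMiddle 0ℓ) {T : FmSet} (thy : IsRCTheory T)
                {A : Fm} (A⊢T : ∀ B → T B → A ⊢ B) where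
  open Classical lem

  b : Fm → ℕ → Tm
  b B = chain (o B)

  cnf-b : ∀ B i → IsCNF (b B i)
  cnf-b B = cnf-chain (cnf-o B)

  b-∧ˡ : ∀ B C → b B ≤ₚ b (B ∧ C)
  b-∧ˡ B C = Mod-⊆⇒chain-≥ {B ∧ C} {B} λ _ → proj₁

  b-∧ʳ : ∀ B C → b C ≤ₚ b (B ∧ C)
  b-∧ʳ B C = Mod-⊆⇒chain-≥ {B ∧ C} {C} λ _ → proj₂

  UpperBound : ℕ → Tm → Set
  UpperBound i u = ∀ B → T B → b B i ≤ᵗ u

  sup : ∀ i → Σ Tm λ m → IsCNF m × UpperBound i m × (∀ {y} → IsCNF y → UpperBound i y → m ≤ᵗ y)
  sup i = least (UpperBound i) (cnf-b A i) λ B B∈T → Mod-⊆⇒chain-≥ (sound (A⊢T B B∈T)) i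

  g : ℕ → Tm
  g i = proj₁ (sup i)

  cnf-g : ∀ i → IsCNF (g i)
  cnf-g i = proj₁ (proj₂ (sup i))

  g-upper : ∀ i → UpperBound i (g i)
  g-upper i = proj₁ (proj₂ (proj₂ (sup i)))

  g-least : ∀ i {y} → IsCNF y → UpperBound i y → g i ≤ᵗ y
  g-least i = proj₂ (proj₂ (proj₂ (sup i)))

  below-g : ∀ i {u} → IsCNF u → u <ᵗ g i → Σ Fm λ C → T C × u <ᵗ b C i
  below-g i {u} cu u<gᵢ with lem {Σ Fm λ C → T C × u <ᵗ b C i}
  ... | yes C = C
  ... | no ∄C = ⊥-elim (≤ᵗ⇒≯ (g-least i cu λ B B∈T → ≮ᵗ⇒≥ λ u<bB → ∄C (B , B∈T , u<bB)) u<gᵢ)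

  g-attained : ∀ i {p e} → g i ≡ snoc p e → ∀ {C} → T C → e ≤ᵗ b C (suc i) →
               Σ Fm λ D → T D × b C ≤ₚ b D × b D i ≡ g i
  g-attained i {p} {e} gᵢ≡ {C} C∈T e≤ =
    D , D∈T , b-∧ˡ C C′ , ≤ᵗ-antisym (g-upper i D D∈T) (subst (_≤ᵗ b D i) (sym gᵢ≡) snoc≤bD)
    where
    cp = proj₁ (cnf-snoc⁻¹ p (subst IsCNF gᵢ≡ (cnf-g i)))
    below = below-g i cp (subst (p <ᵗ_) (sym gᵢ≡) (<-snoc p e))
    C′ = proj₁ below
    D = C ∧ C′
    D∈T = thy-∧ thy C∈T (proj₁ (proj₂ below))
    snoc≤bD : snoc p e ≤ᵗ b D i
    snoc≤bD = snoc-≤-chain i (cnf-o D) (<-≤ᵗ-trans (proj₂ (proj₂ below)) (b-∧ʳ C C′ i))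
                                     (≤ᵗ-trans e≤ (b-∧ˡ C C′ (suc i)))

  g-wf : ∀ i → g (suc i) ≤ᵗ ℓ (g i)
  g-wf i = ≮ᵗ⇒≥ λ ℓgᵢ<gᵢ₊₁ →
    let B , B∈T , ℓgᵢ<bB = below-g (suc i) (cnf-ℓ (cnf-g i)) ℓgᵢ<gᵢ₊₁
    in impossible B∈T ℓgᵢ<bB (𝟎-or-snoc (g i))
    where
    ℓ-b : ∀ D → ℓ (b D i) ≡ b D (suc i)
    ℓ-b D = ℓ-chain (o D) i
    impossible : ∀ {B} → T B → ℓ (g i) <ᵗ b B (suc i) →
                 g i ≡ 𝟎 ⊎ Σ Tm (λ p → Σ Tm λ e → g i ≡ snoc p e) → ⊥
    impossible {B} B∈T lt (inj₁ gᵢ≡𝟎) = ≮𝟎 (subst (ℓ (g i) <ᵗ_) (trans (sym (ℓ-b B)) (cong ℓ bBᵢ≡𝟎)) lt)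
      where bBᵢ≡𝟎 = ≤ᵗ𝟎⇒≡𝟎 (subst (b B i ≤ᵗ_) gᵢ≡𝟎 (g-upper i B B∈T))
    impossible {B} B∈T lt (inj₂ (p , e , gᵢ≡)) =
      let ℓgᵢ≡e = trans (cong ℓ gᵢ≡) (ℓ-snoc p e)
          D , _ , bB≤bD , bDᵢ≡gᵢ = g-attained i gᵢ≡ B∈T (inj₁ (subst (_<ᵗ b B (suc i)) ℓgᵢ≡e lt))
          bD₊≡ℓgᵢ = trans (sym (ℓ-b D)) (cong ℓ bDᵢ≡gᵢ)
      in <ᵗ-irrefl (<-≤ᵗ-trans lt (subst (b B (suc i) ≤ᵗ_) bD₊≡ℓgᵢ (bB≤bD (suc i))))

  γ : ISeq
  γ = iseq (λ i → ord (g i) (cnf-g i)) g-wf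

  T⊆⟦γ⟧ : T ⊆ ⟦ γ ⟧
  T⊆⟦γ⟧ B B∈T = proj₂ (Mod≐Above B) γ λ i → g-upper i B B∈T

  -- Built downwards from the index where chain (o B) vanishes.
  dominated-from : ∀ B → b B ≤ₚ g → ∀ i → Σ Fm λ D → T D × (∀ {j} → i ≤ℕ j → b B j ≤ᵗ b D j)
  dominated-from B bB≤g = downward-induction K
    (λ K≤i → ⊤' , thy-⊤ thy , λ i≤j → vanishes (ℕ.≤-trans K≤i i≤j)) step
    where
    K = proj₁ (eventually-𝟎 (chainI (cnf-o B)))
    vanishes : ∀ {j} → K ≤ℕ j → b B j ≤ᵗ b ⊤' j
    vanishes K≤j = subst (_≤ᵗ _) (sym (proj₂ (eventually-𝟎 (chainI (cnf-o B))) K≤j)) 𝟎≤ᵗ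
    extend : ∀ i {C D} → T C → T D → b B i ≤ᵗ b C i → (∀ {j} → suc i ≤ℕ j → b B j ≤ᵗ b D j) →
             Σ Fm λ E → T E × (∀ {j} → i ≤ℕ j → b B j ≤ᵗ b E j)
    extend i {C} {D} C∈T D∈T atᵢ after = C ∧ D , thy-∧ thy C∈T D∈T , λ {j} i≤j →
      case ℕ.m≤n⇒m<n∨m≡n i≤j of λ
        { (inj₁ i<j)  → ≤ᵗ-trans (after i<j) (b-∧ʳ C D j)
        ; (inj₂ refl) → ≤ᵗ-trans atᵢ (b-∧ˡ C D i) }
    step : ∀ i → (Σ Fm λ D → T D × (∀ {j} → suc i ≤ℕ j → b B j ≤ᵗ b D j)) →
           Σ Fm λ D → T D × (∀ {j} → i ≤ℕ j → b B j ≤ᵗ b D j)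
    step i (D , D∈T , after) with bB≤g i | 𝟎-or-snoc (g i)
    ... | inj₁ bBᵢ<gᵢ | _ =
      let C , C∈T , bBᵢ<bC = below-g i (cnf-b B i) bBᵢ<gᵢ
      in extend i C∈T D∈T (inj₁ bBᵢ<bC) after
    ... | inj₂ bBᵢ≡gᵢ | inj₁ gᵢ≡𝟎 =
      extend i (thy-⊤ thy) D∈T (subst (_≤ᵗ _) (sym (trans bBᵢ≡gᵢ gᵢ≡𝟎)) 𝟎≤ᵗ) after
    ... | inj₂ bBᵢ≡gᵢ | inj₂ (p , e , gᵢ≡) =
      let e≡bB₊ = trans (sym (ℓ-snoc p e))
                        (trans (cong ℓ (sym (trans bBᵢ≡gᵢ gᵢ≡))) (ℓ-chain (o B) i))
          E , E∈T , _ , bEᵢ≡gᵢ =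
            g-attained i gᵢ≡ D∈T (subst (_≤ᵗ b D (suc i)) (sym e≡bB₊) (after ℕ.≤-refl))
      in extend i E∈T D∈T (inj₂ (trans bBᵢ≡gᵢ (sym bEᵢ≡gᵢ))) after

  ⟦γ⟧⊆T : ⟦ γ ⟧ ⊆ T
  ⟦γ⟧⊆T B γ⊩B =
    let D , D∈T , dominated = dominated-from B (proj₁ (Mod≐Above B) γ γ⊩B) 0
    in thy-⊢ thy D∈T (complete λ β β⊩D →
         proj₂ (Mod≐Above B) β λ j → ≤ᵗ-trans (dominated {j} z≤n) (proj₁ (Mod≐Above D) β β⊩D j))

⟦⟧-onto : ExcludedMiddle 0ℓ → ∀ T → IsBddTheory T → ∃ λ α → ⟦ α ⟧ ≐ T
⟦⟧-onto lem T (thy , A , A⊢T) = γ , ⟦γ⟧⊆T , T⊆⟦γ⟧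
  where open Supremum lem thy A⊢T

-- Cones

v-⟦⟧ : ∀ {T γ} → ⟦ γ ⟧ ≐ T → v T ≐I λ δ → ⌊ γ ⌋ ≤ₚ ⌊ δ ⌋
v-⟦⟧ (γ⊆T , T⊆γ) = (λ δ δ⊩T → ⟦⟧-⊆⇒≥ λ B γ⊩B → δ⊩T B (γ⊆T B γ⊩B)) ,
                   (λ δ γ≤δ B B∈T → ⊩-upward B γ≤δ (T⊆γ B B∈T))

Cone∩I-toE : ∀ γ → Cone∩I (toE γ) ≐I λ δ → ⌊ γ ⌋ ≤ₚ ⌊ δ ⌋
Cone∩I-toE γ = (λ δ γ≤δ i → fin≤fin⁻¹ (γ≤δ i)) , (λ δ γ≤δ i → fin≤fin (γ≤δ i))
  where
  fin≤fin⁻¹ : ∀ {a b} → fin a ≤ε fin b → tm a ≤ᵗ tm b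
  fin≤fin⁻¹ (fin≤fin a≤b) = a≤b

≤RC⇒v-⊆ : ∀ {T S} → T ≤RC S → v T ⊆I v S
≤RC⇒v-⊆ S⊆T δ δ⊩T B B∈S = δ⊩T B (S⊆T B B∈S)

module _ (lem : ExcludedMiddle 0ℓ) where

  v-isCone : ∀ T → IsBddTheory T → IsCone (v T)
  v-isCone T bdd =
    let γ , ⟦γ⟧≐T = ⟦⟧-onto lem T bdd
        vT≐ = v-⟦⟧ ⟦γ⟧≐T
    in (toE γ , ≐I-trans vT≐ (≐I-sym (Cone∩I-toE γ))) , γ , proj₂ vT≐ γ (λ _ → ≤ᵗ-refl)

  v-⊆⇒≤RC : ∀ T S → IsBddTheory T → v T ⊆I v S → T ≤RC S
  v-⊆⇒≤RC T S bdd vT⊆vS B B∈S =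
    let γ , γ⊆T , T⊆γ = ⟦⟧-onto lem T bdd
    in γ⊆T B (vT⊆vS γ T⊆γ B B∈S)

  v-injective : ∀ T S → IsBddTheory T → IsBddTheory S → v T ≐I v S → T ≐ S
  v-injective T S bddT bddS (vT⊆vS , vS⊆vT) = v-⊆⇒≤RC S T bddS vS⊆vT , v-⊆⇒≤RC T S bddT vT⊆vS

  -- T is the theory of the cone; its witness γ from ⟦⟧-onto lies above the apex α, since
  -- otherwise sep i (γ i) would belong to T without being forced by γ.
  v-onto-cones : ∀ K → IsCone K → ∃ λ T → IsBddTheory T × v T ≐I K
  v-onto-cones K ((α , K⊆ , ⊆K) , β₀ , β₀∈K) = T , bdd , vT⊆K , λ δ δ∈K B B∈T → B∈T δ δ∈K
    where
    T : FmSet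
    T B = ∀ β → K β → β ⊩ B
    bdd : IsBddTheory T
    bdd = (λ As B hs d β β∈K → sound d β (⊩-conj (All.map (λ h → h β β∈K) hs))) ,
          (let F , F⊢ = ⟦⟧-bounded β₀ in F , λ B B∈T → F⊢ B (B∈T β₀ β₀∈K))
    witness = ⟦⟧-onto lem T bdd
    γ = proj₁ witness
    apex≤γ : ∀ i → α i ≤ε fin (seq γ i)
    apex≤γ i with α i | K⊆ β₀ β₀∈K i | (λ β β∈K → K⊆ β β∈K i)
    ... | fin a | fin≤fin _ | α≤K with <ᵗ-cmp (⌊ γ ⌋ i) (tm a)
    ...   | tri≈ _ γᵢ≡a _ = fin≤fin (inj₂ (sym γᵢ≡a))
    ...   | tri> _ _ a<γᵢ = fin≤fin (inj₁ a<γᵢ)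
    ...   | tri< γᵢ<a _ _ = ⊥-elim (<ᵗ-irrefl (proj₁ sepᵢ γ (proj₂ (proj₂ witness) _ sepᵢ∈T)))
      where
      sepᵢ = Mod-sep i (cnf (seq γ i))
      sepᵢ∈T : T (sep i (⌊ γ ⌋ i))
      sepᵢ∈T β β∈K with α≤K β β∈K
      ... | fin≤fin a≤βᵢ = proj₂ sepᵢ β (<-≤ᵗ-trans γᵢ<a a≤βᵢ)
    vT⊆K : v T ⊆I K
    vT⊆K δ δ∈vT = ⊆K δ λ i → ≤ε-trans (apex≤γ i) (fin≤fin (proj₁ (v-⟦⟧ (proj₂ witness)) δ δ∈vT i))
      where
      ≤ε-trans : ∀ {e a b} → e ≤ε fin a → fin a ≤ε fin b → e ≤ε fin b
      ≤ε-trans (fin≤fin e≤a) (fin≤fin a≤b) = fin≤fin (≤ᵗ-trans e≤a a≤b)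

proposition7 : ExcludedMiddle 0ℓ →
    ( (∀ α → IsBddTheory ⟦ α ⟧)
    × (∀ α β → (α ≤I β → ⟦ α ⟧ ≤RC ⟦ β ⟧) × (⟦ α ⟧ ≤RC ⟦ β ⟧ → α ≤I β))
    × (∀ α β → ⟦ α ⟧ ≐ ⟦ β ⟧ → α ≡I β)
    × (∀ T → IsBddTheory T → ∃ λ α → ⟦ α ⟧ ≐ T) )
    ×
    ( (∀ T → IsBddTheory T → IsCone (v T))
    × (∀ T S → IsBddTheory T → IsBddTheory S →
         (T ≤RC S → v T ⊆I v S) × (v T ⊆I v S → T ≤RC S))
    × (∀ T S → IsBddTheory T → IsBddTheory S → v T ≐I v S → T ≐ S)
    × (∀ K → IsCone K → ∃ λ T → IsBddTheory T × (v T ≐I K)) )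
proposition7 lem =
  ( ⟦⟧-isBddTheory
  , (λ α β → ⟦⟧-antitone , ⟦⟧-⊆⇒≥)
  , (λ α β → ⟦⟧-injective)
  , ⟦⟧-onto lem )
  , ( v-isCone lem
    , (λ T S bddT _ → ≤RC⇒v-⊆ , v-⊆⇒≤RC lem T S bddT)
    , v-injective lem
    , v-onto-cones lem )
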